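{- Let $L\subseteq R$. Consider axiom systems $\mathcal{A}$ satisfying $\mathcal{A}\sim\mathcal{A}_L\cup\{\tau^{\mathcal{A}}\}$. (a) If $D\cap L-\{\max L\}\neq\emptyset$, then every consistent such $\mathcal{A}$ is equivalent to $\mathcal{A}_L$, and $D^{\mathcal{A}}_{\mathrm{surpr}}=D\cap L-\{\max L\}$. (b) If $D\cap L\subseteq\{\max L\}$, then every such $\mathcal{A}$ is inconsistent, and $D^{\mathcal{A}}_{\mathrm{surpr}}=\emptyset$.
   Context: Let $R=\{\mathrm{Mo},\mathrm{Tu},\mathrm{We},\mathrm{Th},\mathrm{Fr},\mathrm{none}\}$ be linearly ordered by $\mathrm{Mo}<\mathrm{Tu}<\mathrm{We}<\mathrm{Th}<\mathrm{Fr}<\mathrm{none}$, and $D=\{\mathrm{Mo},\dots,\mathrm{Fr}\}$. Propositional formulas are built from atoms $Y_r$ ($r\in R$) with $\bot,\to$ (usual derived connectives, $\top:=\neg\bot$). The axiom $(\mathrm{Ax}_{=1})$ is $\bigvee_{r\in R}Y_r\wedge\bigwedge_{r<s}(\neg Y_r\vee\neg Y_s)$; its models are identified with the elements of $R$ ($r$ makes exactly $Y_r$ true). An axiom system $\mathcal{A}$ is a set of formulas always containing $(\mathrm{Ax}_{=1})$; $\mathcal{A}\vdash\varphi$ is propositional provability; $\mathcal{A}$ is inconsistent if it proves every formula, consistent otherwise. Two axiom systems are equivalent, $\mathcal{A}_1\sim\mathcal{A}_2$, if each proves every formula of the other. For $B\subseteq R$: $\langle T\in B\rangle:=\bigvee_{r\in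 B}Y_r$, $\langle T\le d\rangle:=\langle T\in\{r:r\le d\}\rangle$. $\mathcal{A}_L$ denotes the axiom system $\{(\mathrm{Ax}_{=1}),\langle T\in L\rangle\}$. $K\subseteq R$ is an $\mathcal{A}$-p-knowledge set if $\mathcal{A}\vdash\langle T\in K\rangle$; $K_{\mathcal{A}}$ is the intersection of all of them. $d\in D$ is $\mathcal{A}$-p-surprising if $d\in K_{\mathcal{A}}$ and $\mathcal{A}\nvdash\langle T\le d\rangle$; $D^{\mathcal{A}}_{\mathrm{surpr}}$ is the set of these. Iverson brackets: $[S]$ is $\top$ if the assertion $S$ is true, $\bot$ otherwise. Define $\tau^{\mathcal{A}}:=\bigvee_{d\in D}\bigwedge_{K\subseteq R}\bigl([\,\mathcal{A}\vdash\langle T\in K\rangle\,]\to[\,d\in K-\{\max K\}\,]\bigr)$, with the convention $\emptyset-\{\max\emptyset\}=\emptyset$. -}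

module Defs where

open import Data.Nat using (ℕ; zero; suc; _<_; _<ᵇ_; _≤ᵇ_)
open import Data.Fin using (Fin; zero; suc; toℕ)
open import Data.Fin.Properties using () renaming (_≟_ to _≟ᶠ_)
open import Data.Fin.Subset using (Subset; _∈_; _∉_; inside; outside)
open import Data.Fin.Subset.Properties using (_∈?_)
open import Data.Bool using (Bool; true; false; if_then_else_; _∧_; not)
open import Data.Maybe using (Maybe; just; nothing)
open import Data.Vec using (Vec; []; _∷_; lookup; tabulate)
open import Data.List using (List; []; _∷_; [_]; foldr; map; concatMap; allFin; filterᵇ)
open import Data.Product using (Σ; _×_; _,_; ∃)
open import Data.Sum using (_⊎_)
open import Data.Empty using (⊥)
open import Relation.Nullary using (¬_; does)
open import Relation.Binary.PropositionalEquality using (_≡_; _≢_)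
open import Function.Bundles using (_⇔_)

-- The set R = {Mo,Tu,We,Th,Fr,none} is Fin 6, with
-- Mo = 0, Tu = 1, We = 2, Th = 3, Fr = 4, none = 5,
-- ordered by the natural order of indices.  D = {Mo,…,Fr} = {r | toℕ r < 5}.

R : Set
R = Fin 6

InD : R → Set
InD d = toℕ d < 5

days : List R
days = filterᵇ (λ r → toℕ r <ᵇ 5) (allFin 6)

infixr 5 _⇒_
data Formula : Set where
  Y   : R → Formula
  ⊥′  : Formula
  _⇒_ : Formula → Formula → Formula

¬′_ : Formula → Formula
¬′ φ = φ ⇒ ⊥′

⊤′ : Formula
⊤′ = ¬′ ⊥′

_∨′_ : Formula → Formula → Formula
φ ∨′ ψ = (¬′ φ) ⇒ ψ

_∧′_ : Formula → Formula → Formula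
φ ∧′ ψ = ¬′ (φ ⇒ ¬′ ψ)

⋁ : List Formula → Formula
⋁ = foldr _∨′_ ⊥′

⋀ : List Formula → Formula
⋀ = foldr _∧′_ ⊤′

AxSys : Set₁
AxSys = Formula → Set

infix 3 _⊢_
data _⊢_ (A : AxSys) : Formula → Set where
  hyp : ∀ {φ} → A φ → A ⊢ φ
  axK : ∀ {φ ψ} → A ⊢ φ ⇒ (ψ ⇒ φ)
  axS : ∀ {φ ψ χ} → A ⊢ (φ ⇒ (ψ ⇒ χ)) ⇒ ((φ ⇒ ψ) ⇒ (φ ⇒ χ))
  axDN : ∀ {φ} → A ⊢ ¬′ (¬′ φ) ⇒ φ
  mp : ∀ {φ ψ} → A ⊢ φ ⇒ ψ → A ⊢ φ → A ⊢ ψ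

Inconsistent : AxSys → Set
Inconsistent A = ∀ φ → A ⊢ φ

Consistent : AxSys → Set
Consistent A = ¬ Inconsistent A

_∼_ : AxSys → AxSys → Set
A₁ ∼ A₂ = (∀ φ → A₂ φ → A₁ ⊢ φ) × (∀ φ → A₁ φ → A₂ ⊢ φ)

_∪｛_｝ : AxSys → Formula → AxSys
(A ∪｛ φ ｝) ψ = A ψ ⊎ ψ ≡ φ

pairsLt : List (R × R)
pairsLt = concatMap (λ r → concatMap (λ s → if toℕ r <ᵇ toℕ s then [ (r , s) ] else []) (allFin 6)) (allFin 6)

Ax=1 : Formula
Ax=1 = ⋁ (map Y (allFin 6)) ∧′ ⋀ (map (λ { (r , s) → (¬′ Y r) ∨′ (¬′ Y s) }) pairsLt)

⟨T∈_⟩ : Subset 6 → Formula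
⟨T∈ B ⟩ = ⋁ (map Y (filterᵇ (λ r → lookup B r) (allFin 6)))

≤set : R → Subset 6
≤set d = tabulate (λ r → toℕ r ≤ᵇ toℕ d)

⟨T≤_⟩ : R → Formula
⟨T≤ d ⟩ = ⟨T∈ ≤set d ⟩

𝒜 : Subset 6 → AxSys
𝒜 L φ = φ ≡ Ax=1 ⊎ φ ≡ ⟨T∈ L ⟩

-- max K and K − {max K}  (max ∅ undefined: nothing; then ∅ − {max ∅} = ∅)

maxSub : ∀ {n} → Subset n → Maybe (Fin n)
maxSub [] = nothing
maxSub (b ∷ v) with maxSub v
... | just i  = just (suc i)
... | nothing = if b then just zero else nothing

isMax : ∀ {n} → Subset n → Fin n → Bool
isMax K i with maxSub K
... | just m  = does (m ≟ᶠ i)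
... | nothing = false

removeMax : ∀ {n} → Subset n → Subset n
removeMax K = tabulate (λ i → lookup K i ∧ not (isMax K i))

InKA : AxSys → R → Set
InKA A d = ∀ (K : Subset 6) → A ⊢ ⟨T∈ K ⟩ → d ∈ K

Surprising : AxSys → R → Set
Surprising A d = InD d × InKA A d × ¬ (A ⊢ ⟨T≤ d ⟩)

-- Iverson brackets [A ⊢ ⟨T∈K⟩] depend on an undecidable assertion,
-- so they are given by a bracket valuation β : Subset 6 → Bool which is
-- required to be *correct*: β K ≡ true iff A ⊢ ⟨T∈K⟩.

allSubsets : ∀ n → List (Subset n)
allSubsets zero = [ [] ]
allSubsets (suc n) = concatMap (λ v → (inside ∷ v) ∷ (outside ∷ v) ∷ []) (allSubsets n)

iv : Bool → Formula
iv true = ⊤′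
iv false = ⊥′

τ : (Subset 6 → Bool) → Formula
τ β = ⋁ (map (λ d → ⋀ (map (λ K → iv (β K) ⇒ iv (does (d ∈? removeMax K))) (allSubsets 6))) days)

CorrectBrackets : AxSys → (Subset 6 → Bool) → Set
CorrectBrackets A β = ∀ (K : Subset 6) → (β K ≡ true) ⇔ (A ⊢ ⟨T∈ K ⟩)

SelfRef : Subset 6 → AxSys → Set
SelfRef L A = Σ (Subset 6 → Bool) λ β → CorrectBrackets A β × (A ∼ (𝒜 L ∪｛ τ β ｝))

{-# OPTIONS --safe #-}
module Submission where

-- Every Iverson bracket in τ^A is ⊤ or ⊥, so τ^A contains no atom: it is either
-- provable in every axiom system and true under every valuation, or refutable in
-- every axiom system.  If it is refutable, A ∼ A_L ∪ {τ^A} proves τ^A and ¬τ^A and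
-- is inconsistent.  Otherwise A ∼ A_L, whose models are the days r ∈ L; so
-- A ⊢ ⟨T∈K⟩ iff L ⊆ K, K_A = L, and d ∈ L is surprising iff L ⊈ {r | r ≤ d}, that
-- is iff d ∈ L − {max L}.  In that case τ^A is true, and as L is a knowledge set
-- it yields a day in D ∩ (L − {max L}); under the hypothesis of (b) there is none.

open import Defs
open import Data.Bool using (Bool; true; false; T; T?; _∧_; not)
open import Data.Bool.Properties using (T-≡; T-∧; T-not-≡)
open import Data.Empty using (⊥-elim)
open import Data.Fin using (Fin; zero; suc; toℕ; _≤_; _<_)
open import Data.Fin.Properties using (≤∧≢⇒<) renaming (_≟_ to _≟ᶠ_)
open import Data.Fin.Subset using (Subset; _∈_; _∉_; _⊆_)
open import Data.Fin.Subset.Properties using (_∈?_)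
open import Data.List using (List; []; _∷_; map; filterᵇ; allFin)
open import Data.List.Membership.Propositional using (find) renaming (_∈_ to _∈ˡ_)
open import Data.List.Membership.Propositional.Properties
  using (∈-filter⁺; ∈-filter⁻; ∈-allFin; ∈-concatMap⁺)
open import Data.List.Relation.Unary.All as All using (All; []; _∷_)
open import Data.List.Relation.Unary.Any as Any using (Any; here; there)
open import Data.Maybe using (just; nothing)
open import Data.Nat using (ℕ; s≤s; z≤n; _<ᵇ_; _≤ᵇ_)
open import Data.Nat.Properties using (<ᵇ⇒<; ≤ᵇ⇒≤; ≤⇒≤ᵇ; <⇒≱)
open import Data.Product using (_×_; _,_; ∃; proj₁; proj₂; uncurry) renaming (map to map×)
open import Data.Sum using (_⊎_; inj₁; inj₂)
open import Data.Vec using ([]; _∷_; lookup; here; there)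
open import Data.Vec.Properties using (lookup∘tabulate; []=⇒lookup; lookup⇒[]=)
open import Function using (_∘_; id; case_of_)
open import Function.Properties.Equivalence using () renaming (trans to ⇔-trans)
open import Function.Bundles using (_⇔_; mk⇔; Equivalence)
open import Relation.Nullary using (¬_; Dec; does; yes; no)
open import Relation.Binary.PropositionalEquality
  using (_≡_; _≢_; refl; sym; trans; cong; cong₂; subst)

open Equivalence using (to; from)

variable
  n : ℕ
  A B : AxSys
  φ ψ χ : Formula
  X : Set
  f : X → Formula
  xs : List X

⊢-id : A ⊢ φ ⇒ φ
⊢-id {φ = φ} = mp (mp axS axK) (axK {ψ = φ})

⊢-explosion : A ⊢ ⊥′ → A ⊢ φ
⊢-explosion p = mp axDN (mp axK p)

⊢-cut : (∀ ψ → A ψ → B ⊢ ψ) → A ⊢ φ → B ⊢ φ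
⊢-cut B⊢A (hyp a)  = B⊢A _ a
⊢-cut B⊢A axK      = axK
⊢-cut B⊢A axS      = axS
⊢-cut B⊢A axDN     = axDN
⊢-cut B⊢A (mp p q) = mp (⊢-cut B⊢A p) (⊢-cut B⊢A q)

assumption : (A ∪｛ φ ｝) ⊢ φ
assumption = hyp (inj₂ refl)

weaken : A ⊢ ψ → (A ∪｛ φ ｝) ⊢ ψ
weaken = ⊢-cut (λ _ a → hyp (inj₁ a))

deduction : (A ∪｛ φ ｝) ⊢ ψ → A ⊢ φ ⇒ ψ
deduction (hyp (inj₁ a))    = mp axK (hyp a)
deduction (hyp (inj₂ refl)) = ⊢-id
deduction axK               = mp axK axK
deduction axS               = mp axK axS
deduction axDN              = mp axK axDN
deduction (mp p q)          = mp (mp axS (deduction p)) (deduction q)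

⇒-trans : A ⊢ φ ⇒ ψ → A ⊢ ψ ⇒ χ → A ⊢ φ ⇒ χ
⇒-trans p q = deduction (mp (weaken q) (mp (weaken p) assumption))

⇒-vacuous : A ⊢ ¬′ φ → A ⊢ φ ⇒ ψ
⇒-vacuous ¬φ = deduction (⊢-explosion (mp (weaken ¬φ) assumption))

¬⇒-intro : A ⊢ φ → A ⊢ ¬′ ψ → A ⊢ ¬′ (φ ⇒ ψ)
¬⇒-intro φ ¬ψ = deduction (mp (weaken ¬ψ) (mp assumption (weaken φ)))

∨-introˡ : A ⊢ φ ⇒ (φ ∨′ ψ)
∨-introˡ = deduction (deduction (⊢-explosion (mp assumption (weaken assumption))))

∨-elim : A ⊢ φ ⇒ χ → A ⊢ ψ ⇒ χ → A ⊢ (φ ∨′ ψ) ⇒ χ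
∨-elim {A} {φ} {χ} {ψ} φ⇒χ ψ⇒χ = deduction (mp axDN (deduction absurd))
  where
    Γ : AxSys
    Γ = (A ∪｛ φ ∨′ ψ ｝) ∪｛ ¬′ χ ｝

    ¬φ : Γ ⊢ ¬′ φ
    ¬φ = deduction (mp (weaken assumption) (mp (weaken (weaken (weaken φ⇒χ))) assumption))

    absurd : Γ ⊢ ⊥′
    absurd = mp assumption (mp (weaken (weaken ψ⇒χ)) (mp (weaken assumption) ¬φ))

⋁-intro : {x : X} → x ∈ˡ xs → A ⊢ f x ⇒ ⋁ (map f xs)
⋁-intro (here refl) = ∨-introˡ
⋁-intro (there x∈) = ⇒-trans (⋁-intro x∈) axK

⋁-elim : (∀ {x} → x ∈ˡ xs → A ⊢ f x ⇒ χ) → A ⊢ ⋁ (map f xs) ⇒ χ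
⋁-elim {xs = []}     _    = ⇒-vacuous ⊢-id
⋁-elim {xs = x ∷ xs} elim = ∨-elim (elim (here refl)) (⋁-elim (elim ∘ there))

⊢-contradiction : A ⊢ φ → A ⊢ ¬′ φ → Inconsistent A
⊢-contradiction ⊢φ ⊢¬φ _ = ⊢-explosion (mp ⊢¬φ ⊢φ)

∼⇒⊢⇔ : A ∼ B → (A ⊢ φ) ⇔ (B ⊢ φ)
∼⇒⊢⇔ (B⊆A , A⊆B) = mk⇔ (⊢-cut A⊆B) (⊢-cut B⊆A)

∼-drop-provable : A ∼ (B ∪｛ φ ｝) → B ⊢ φ → A ∼ B
∼-drop-provable (B∪φ⊆A , A⊆B∪φ) B⊢φ =
  (λ ψ b → B∪φ⊆A ψ (inj₁ b)) ,
  (λ ψ a → ⊢-cut (λ { _ (inj₁ b) → hyp b ; _ (inj₂ refl) → B⊢φ }) (A⊆B∪φ ψ a))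

∈⇔lookup : {i : Fin n} {K : Subset n} → i ∈ K ⇔ T (lookup K i)
∈⇔lookup {i = i} {K} = mk⇔ (from T-≡ ∘ []=⇒lookup) (lookup⇒[]= i K ∘ to T-≡)

members : Subset n → List (Fin n)
members {n} K = filterᵇ (lookup K) (allFin n)

∈-members : {i : Fin n} {K : Subset n} → i ∈ˡ members K ⇔ i ∈ K
∈-members {n} {i} {K} = mk⇔
  (from ∈⇔lookup ∘ proj₂ ∘ ∈-filter⁻ (T? ∘ lookup K) {xs = allFin n})
  (∈-filter⁺ (T? ∘ lookup K) (∈-allFin i) ∘ to ∈⇔lookup)

maxSub-nothing : ∀ (K : Subset n) {i} → maxSub K ≡ nothing → i ∉ K
maxSub-nothing (b ∷ K) eq i∈K with maxSub K in e
maxSub-nothing (false ∷ K) refl (there i∈K) | nothing = maxSub-nothing K e i∈K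

maxSub-just : ∀ (K : Subset n) {i} → i ∈ K → ∃ λ m → maxSub K ≡ just m
maxSub-just K i∈K with maxSub K in e
... | just m  = m , refl
... | nothing = ⊥-elim (maxSub-nothing K e i∈K)

maxSub-∈ : ∀ (K : Subset n) {m} → maxSub K ≡ just m → m ∈ K
maxSub-∈ (b ∷ K) eq with maxSub K in e
maxSub-∈ (b ∷ K)    refl | just _  = there (maxSub-∈ K e)
maxSub-∈ (true ∷ K) refl | nothing = here

maxSub-≥ : ∀ (K : Subset n) {m i} → maxSub K ≡ just m → i ∈ K → i ≤ m
maxSub-≥ (b ∷ K) eq i∈K with maxSub K in e
maxSub-≥ (b ∷ K)    refl here        | just _  = z≤n
maxSub-≥ (b ∷ K)    refl (there i∈K) | just _  = s≤s (maxSub-≥ K e i∈K)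
maxSub-≥ (true ∷ K) refl here        | nothing = z≤n
maxSub-≥ (true ∷ K) refl (there i∈K) | nothing = ⊥-elim (maxSub-nothing K e i∈K)

isMax⇔ : ∀ (K : Subset n) {i} → isMax K i ≡ true ⇔ maxSub K ≡ just i
isMax⇔ K {i} with maxSub K
... | nothing = mk⇔ (λ ()) (λ ())
... | just m with m ≟ᶠ i
...   | yes m≡i = mk⇔ (λ _ → cong just m≡i) (λ _ → refl)
...   | no  m≢i = mk⇔ (λ ()) (λ { refl → ⊥-elim (m≢i refl) })

∈-removeMax⇔ : ∀ (K : Subset n) {i} → i ∈ removeMax K ⇔ (i ∈ K × isMax K i ≡ false)
∈-removeMax⇔ K {i} = mk⇔
  (map× (from ∈⇔lookup) (to T-not-≡) ∘ to T-∧ ∘ subst T lookup-removeMax ∘ to ∈⇔lookup)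
  (from ∈⇔lookup ∘ subst T (sym lookup-removeMax) ∘ from T-∧
                 ∘ map× (to ∈⇔lookup) (from T-not-≡))
  where
    lookup-removeMax : lookup (removeMax K) i ≡ (lookup K i ∧ not (isMax K i))
    lookup-removeMax = lookup∘tabulate _ i

removeMax-⊆ : ∀ (K : Subset n) → removeMax K ⊆ K
removeMax-⊆ K = proj₁ ∘ to (∈-removeMax⇔ K)

maxSub∉removeMax : ∀ (K : Subset n) {i} → maxSub K ≡ just i → i ∉ removeMax K
maxSub∉removeMax K max i∈
  with () ← trans (sym (from (isMax⇔ K) max)) (proj₂ (to (∈-removeMax⇔ K) i∈))

∉removeMax⇒maxSub : ∀ (K : Subset n) {i} → i ∈ K → i ∉ removeMax K → maxSub K ≡ just i
∉removeMax⇒maxSub K {i} i∈K i∉ with isMax K i in e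
... | true  = to (isMax⇔ K) e
... | false = ⊥-elim (i∉ (from (∈-removeMax⇔ K) (i∈K , e)))

removeMax-below-max : ∀ (K : Subset n) {i} → i ∈ removeMax K → ∃ λ m → m ∈ K × i < m
removeMax-below-max K {i} i∈ with maxSub-just K (removeMax-⊆ K i∈)
... | m , max≡m = m , maxSub-∈ K max≡m , ≤∧≢⇒< (maxSub-≥ K max≡m (removeMax-⊆ K i∈)) i≢m
  where
    i≢m : i ≢ m
    i≢m refl = maxSub∉removeMax K max≡m i∈

∈-≤set⇔ : ∀ {d r} → r ∈ ≤set d ⇔ r ≤ d
∈-≤set⇔ {d} {r} = mk⇔
  (≤ᵇ⇒≤ _ _ ∘ subst T lookup-≤set ∘ to ∈⇔lookup)
  (from ∈⇔lookup ∘ subst T (sym lookup-≤set) ∘ ≤⇒≤ᵇ)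
  where
    lookup-≤set : lookup (≤set d) r ≡ (toℕ r ≤ᵇ toℕ d)
    lookup-≤set = lookup∘tabulate (λ s → toℕ s ≤ᵇ toℕ d) r

∈-removeMax⇔⊈≤set : ∀ {L d} → d ∈ removeMax L ⇔ (d ∈ L × ¬ (L ⊆ ≤set d))
∈-removeMax⇔⊈≤set {L} {d} = mk⇔ below-max-exists (uncurry not-max)
  where
    below-max-exists : d ∈ removeMax L → d ∈ L × ¬ (L ⊆ ≤set d)
    below-max-exists d∈ with removeMax-below-max L d∈
    ... | m , m∈L , d<m =
      removeMax-⊆ L d∈ , λ L⊆≤d → <⇒≱ d<m (to ∈-≤set⇔ (L⊆≤d m∈L))

    not-max : d ∈ L → ¬ (L ⊆ ≤set d) → d ∈ removeMax L
    not-max d∈L L⊈≤d with d ∈? removeMax L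
    ... | yes d∈ = d∈
    ... | no  d∉ =
      ⊥-elim (L⊈≤d (from ∈-≤set⇔ ∘ maxSub-≥ L (∉removeMax⇒maxSub L d∈L d∉)))

⟨T∈⟩-mono : {K K′ : Subset 6} → K ⊆ K′ → A ⊢ ⟨T∈ K ⟩ → A ⊢ ⟨T∈ K′ ⟩
⟨T∈⟩-mono K⊆K′ = mp (⋁-elim (⋁-intro ∘ from ∈-members ∘ K⊆K′ ∘ to ∈-members))

Valuation : Set
Valuation = R → Bool

variable
  v : Valuation

infixr 5 _⇒ᵇ_
_⇒ᵇ_ : Bool → Bool → Bool
true  ⇒ᵇ b = b
false ⇒ᵇ _ = true

⟦_⟧ : Formula → Valuation → Bool
⟦ Y r ⟧   v = v r
⟦ ⊥′ ⟧    v = false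
⟦ φ ⇒ ψ ⟧ v = ⟦ φ ⟧ v ⇒ᵇ ⟦ ψ ⟧ v

infix 4 _⊨_
_⊨_ : Valuation → Formula → Set
v ⊨ φ = ⟦ φ ⟧ v ≡ true

⇒ᵇ-K : ∀ a b → a ⇒ᵇ b ⇒ᵇ a ≡ true
⇒ᵇ-K true  true  = refl
⇒ᵇ-K true  false = refl
⇒ᵇ-K false _     = refl

⇒ᵇ-S : ∀ a b c → (a ⇒ᵇ b ⇒ᵇ c) ⇒ᵇ (a ⇒ᵇ b) ⇒ᵇ a ⇒ᵇ c ≡ true
⇒ᵇ-S true  true  true  = refl
⇒ᵇ-S true  true  false = refl
⇒ᵇ-S true  false _     = refl
⇒ᵇ-S false _     _     = refl

⇒ᵇ-DN : ∀ a → ((a ⇒ᵇ false) ⇒ᵇ false) ⇒ᵇ a ≡ true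
⇒ᵇ-DN true  = refl
⇒ᵇ-DN false = refl

⇒ᵇ-mp : ∀ {a b} → a ⇒ᵇ b ≡ true → a ≡ true → b ≡ true
⇒ᵇ-mp a⇒b refl = a⇒b

soundness : (∀ ψ → A ψ → v ⊨ ψ) → A ⊢ φ → v ⊨ φ
soundness     v⊨A (hyp a)             = v⊨A _ a
soundness {v = v} _ (axK {φ} {ψ})     = ⇒ᵇ-K (⟦ φ ⟧ v) (⟦ ψ ⟧ v)
soundness {v = v} _ (axS {φ} {ψ} {χ}) = ⇒ᵇ-S (⟦ φ ⟧ v) (⟦ ψ ⟧ v) (⟦ χ ⟧ v)
soundness {v = v} _ (axDN {φ})        = ⇒ᵇ-DN (⟦ φ ⟧ v)
soundness     v⊨A (mp p q)            = ⇒ᵇ-mp (soundness v⊨A p) (soundness v⊨A q)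

⊨⋁⁺ : ∀ (f : X → Formula) xs → Any (λ x → v ⊨ f x) xs → v ⊨ ⋁ (map f xs)
⊨⋁⁺ {v = v} f (x ∷ xs) (here v⊨fx) rewrite v⊨fx = refl
⊨⋁⁺ {v = v} f (x ∷ xs) (there v⊨⋁) with ⟦ f x ⟧ v
... | true  = refl
... | false = ⊨⋁⁺ f xs v⊨⋁

⊨⋁⁻ : ∀ (f : X → Formula) xs → v ⊨ ⋁ (map f xs) → Any (λ x → v ⊨ f x) xs
⊨⋁⁻ {v = v} f (x ∷ xs) v⊨⋁ with ⟦ f x ⟧ v in v⊨fx
... | true  = here v⊨fx
... | false = there (⊨⋁⁻ f xs v⊨⋁)

⊨⋀⁻ : ∀ (f : X → Formula) xs → v ⊨ ⋀ (map f xs) → All (λ x → v ⊨ f x) xs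
⊨⋀⁻ f [] _ = []
⊨⋀⁻ {v = v} f (x ∷ xs) v⊨⋀ with ⟦ f x ⟧ v in v⊨fx | ⟦ ⋀ (map f xs) ⟧ v in v⊨rest
... | true | true = v⊨fx ∷ ⊨⋀⁻ f xs v⊨rest

data Closed : Formula → Set where
  closed-⊥ : Closed ⊥′
  closed-⇒ : Closed φ → Closed ψ → Closed (φ ⇒ ψ)

Decided : Formula → Set₁
Decided φ = ((∀ A → A ⊢ φ) × (∀ v → v ⊨ φ))
          ⊎ ((∀ A → A ⊢ ¬′ φ) × (∀ v → ⟦ φ ⟧ v ≡ false))

closed⇒decided : Closed φ → Decided φ
closed⇒decided closed-⊥ = inj₂ ((λ _ → ⊢-id) , (λ _ → refl))
closed⇒decided (closed-⇒ cφ cψ) with closed⇒decided cφ | closed⇒decided cψ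
... | inj₂ (⊢¬φ , φ-false) | _ =
  inj₁ ((λ A → ⇒-vacuous (⊢¬φ A)) , λ v → cong (_⇒ᵇ _) (φ-false v))
... | inj₁ (⊢φ , φ-true) | inj₁ (⊢ψ , ψ-true) =
  inj₁ ((λ A → mp axK (⊢ψ A)) , λ v → cong₂ _⇒ᵇ_ (φ-true v) (ψ-true v))
... | inj₁ (⊢φ , φ-true) | inj₂ (⊢¬ψ , ψ-false) =
  inj₂ ((λ A → ¬⇒-intro (⊢φ A) (⊢¬ψ A)) , λ v → cong₂ _⇒ᵇ_ (φ-true v) (ψ-false v))

closed-⋁ : (f : X → Formula) → (∀ x → Closed (f x)) → ∀ xs → Closed (⋁ (map f xs))
closed-⋁ f c []       = closed-⊥
closed-⋁ f c (x ∷ xs) = closed-⇒ (closed-⇒ (c x) closed-⊥) (closed-⋁ f c xs)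

closed-⋀ : (f : X → Formula) → (∀ x → Closed (f x)) → ∀ xs → Closed (⋀ (map f xs))
closed-⋀ f c []       = closed-⇒ closed-⊥ closed-⊥
closed-⋀ f c (x ∷ xs) =
  closed-⇒ (closed-⇒ (c x) (closed-⇒ (closed-⋀ f c xs) closed-⊥)) closed-⊥

closed-iv : ∀ b → Closed (iv b)
closed-iv true  = closed-⇒ closed-⊥ closed-⊥
closed-iv false = closed-⊥

τ-clause : (Subset 6 → Bool) → R → Subset 6 → Formula
τ-clause β d K = iv (β K) ⇒ iv (does (d ∈? removeMax K))

closed-τ : ∀ β → Closed (τ β)
closed-τ β =
  closed-⋁ _ (λ d → closed-⋀ (τ-clause β d) (closed-τ-clause d) (allSubsets 6)) days
  where
    closed-τ-clause : ∀ d K → Closed (τ-clause β d K)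
    closed-τ-clause d K = closed-⇒ (closed-iv (β K)) (closed-iv (does (d ∈? removeMax K)))

∈-allSubsets : (K : Subset n) → K ∈ˡ allSubsets n
∈-allSubsets []          = here refl
∈-allSubsets (true ∷ K)  =
  ∈-concatMap⁺ _ (Any.map (λ { refl → here refl }) (∈-allSubsets K))
∈-allSubsets (false ∷ K) =
  ∈-concatMap⁺ _ (Any.map (λ { refl → there (here refl) }) (∈-allSubsets K))

days⊆D : {d : R} → d ∈ˡ days → InD d
days⊆D {d} = <ᵇ⇒< (toℕ d) 5 ∘ proj₂ ∘ ∈-filter⁻ (λ r → T? (toℕ r <ᵇ 5)) {xs = allFin 6}

⊨iv⇒iv-does : ∀ v a {P : Set} (P? : Dec P) → v ⊨ iv a ⇒ iv (does P?) → a ≡ true → P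
⊨iv⇒iv-does _ true  (yes p) _  _ = p
⊨iv⇒iv-does _ true  (no _)  () _
⊨iv⇒iv-does _ false _       _  ()

⊨τ⇒ : ∀ v β K → v ⊨ τ β → β K ≡ true → ∃ λ d → InD d × d ∈ removeMax K
⊨τ⇒ v β K v⊨τ βK
  with find (⊨⋁⁻ (λ d → ⋀ (map (τ-clause β d) (allSubsets 6))) days v⊨τ)
... | d , d∈days , v⊨⋀ = d , days⊆D d∈days , d∈removeMax
  where
    d∈removeMax : d ∈ removeMax K
    d∈removeMax = ⊨iv⇒iv-does v (β K) (d ∈? removeMax K)
                    (All.lookup (⊨⋀⁻ (τ-clause β d) _ v⊨⋀) (∈-allSubsets K)) βK

exactly : R → Valuation
exactly r s = does (r ≟ᶠ s)

exactly⊨Y⇔ : ∀ r s → exactly r ⊨ Y s ⇔ r ≡ s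
exactly⊨Y⇔ r s with r ≟ᶠ s
... | yes r≡s = mk⇔ (λ _ → r≡s) (λ _ → refl)
... | no  r≢s = mk⇔ (λ ()) (⊥-elim ∘ r≢s)

exactly⊨⟨T∈⟩⇔ : ∀ r K → exactly r ⊨ ⟨T∈ K ⟩ ⇔ r ∈ K
exactly⊨⟨T∈⟩⇔ r K = mk⇔
  (to ∈-members ∘ Any.map (to (exactly⊨Y⇔ r _)) ∘ ⊨⋁⁻ Y (members K))
  (⊨⋁⁺ Y (members K) ∘ Any.map (from (exactly⊨Y⇔ r _)) ∘ from ∈-members)

exactly⊨Ax=1 : ∀ r → exactly r ⊨ Ax=1
exactly⊨Ax=1 zero                            = refl
exactly⊨Ax=1 (suc zero)                      = refl
exactly⊨Ax=1 (suc (suc zero))                = refl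
exactly⊨Ax=1 (suc (suc (suc zero)))          = refl
exactly⊨Ax=1 (suc (suc (suc (suc zero))))    = refl
exactly⊨Ax=1 (suc (suc (suc (suc (suc zero))))) = refl

KnowsExactly : AxSys → Subset 6 → Set
KnowsExactly A L = ∀ K → (A ⊢ ⟨T∈ K ⟩) ⇔ L ⊆ K

𝒜-knowsExactly : ∀ L → KnowsExactly (𝒜 L) L
𝒜-knowsExactly L K = mk⇔ sound (λ L⊆K → ⟨T∈⟩-mono L⊆K (hyp (inj₂ refl)))
  where
    exactly-models : ∀ {r} → r ∈ L → ∀ ψ → 𝒜 L ψ → exactly r ⊨ ψ
    exactly-models {r} _   _ (inj₁ refl) = exactly⊨Ax=1 r
    exactly-models {r} r∈L _ (inj₂ refl) = from (exactly⊨⟨T∈⟩⇔ r L) r∈L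

    sound : 𝒜 L ⊢ ⟨T∈ K ⟩ → L ⊆ K
    sound ⊢K {r} r∈L = to (exactly⊨⟨T∈⟩⇔ r K) (soundness (exactly-models r∈L) ⊢K)

∼-knowsExactly : ∀ {L} → A ∼ B → KnowsExactly B L → KnowsExactly A L
∼-knowsExactly A∼B knows K = ⇔-trans (∼⇒⊢⇔ A∼B) (knows K)

knowsExactly⇒surprising⇔ : ∀ {L d} → KnowsExactly A L → InD d →
  Surprising A d ⇔ d ∈ removeMax L
knowsExactly⇒surprising⇔ {A} {L} {d} knows d∈D = mk⇔
  (λ (_ , d∈K_A , ⊬≤d) →
    from ∈-removeMax⇔⊈≤set (d∈K_A L (from (knows L) id) , ⊬≤d ∘ from (knows (≤set d))))
  (λ d∈ → let (d∈L , L⊈≤d) = to ∈-removeMax⇔⊈≤set d∈ in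
    d∈D , (λ K ⊢K → to (knows K) ⊢K d∈L) , L⊈≤d ∘ to (knows (≤set d)))

inconsistent⇒¬surprising : ∀ {d} → Inconsistent A → ¬ Surprising A d
inconsistent⇒¬surprising inconsistent (_ , _ , ⊬≤d) = ⊬≤d (inconsistent _)

D∩L⊆max⇒D∩removeMax-empty : ∀ {L} → (∀ d → InD d → d ∈ L → maxSub L ≡ just d) →
  ¬ (∃ λ d → InD d × d ∈ removeMax L)
D∩L⊆max⇒D∩removeMax-empty {L} D∩L⊆max (d , d∈D , d∈) =
  maxSub∉removeMax L (D∩L⊆max d d∈D (removeMax-⊆ L d∈)) d∈

closed-extension-dichotomy : Closed φ → A ∼ (B ∪｛ φ ｝) →
  Inconsistent A ⊎ (A ∼ B × ∀ v → v ⊨ φ)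
closed-extension-dichotomy {φ} {A} {B} closed A∼ with closed⇒decided closed
... | inj₁ (provable , valid) = inj₂ (∼-drop-provable A∼ (provable B) , valid)
... | inj₂ (refutable , _)    =
  inj₁ (⊢-contradiction (proj₁ A∼ φ (inj₂ refl)) (refutable A))

-- Here `with`, or leaving β implicit at the call sites, makes Agda normalise the
-- large formula τ β.
consistent-self-reference : ∀ {L β} → A ∼ (𝒜 L ∪｛ τ β ｝) → Consistent A →
  (A ∼ 𝒜 L) × (∀ d → InD d → Surprising A d ⇔ d ∈ removeMax L)
consistent-self-reference {L = L} {β} A∼ consistent =
  case closed-extension-dichotomy (closed-τ β) A∼ of λ where
    (inj₁ inconsistent) → ⊥-elim (consistent inconsistent)
    (inj₂ (A∼𝒜L , _))   →
      A∼𝒜L , λ d → knowsExactly⇒surprising⇔ (∼-knowsExactly A∼𝒜L (𝒜-knowsExactly L))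

D∩removeMax-empty⇒inconsistent : ∀ {L β} → CorrectBrackets A β → A ∼ (𝒜 L ∪｛ τ β ｝) →
  ¬ (∃ λ d → InD d × d ∈ removeMax L) → Inconsistent A
D∩removeMax-empty⇒inconsistent {A} {L} {β} correct A∼ D∩removeMax-empty =
  case closed-extension-dichotomy (closed-τ β) A∼ of λ where
    (inj₁ inconsistent) → inconsistent
    (inj₂ (A∼𝒜L , ⊨τ))  → ⊥-elim (D∩removeMax-empty (⊨τ⇒ v₀ β L (⊨τ v₀) (βL A∼𝒜L)))
  where
    v₀ : Valuation
    v₀ _ = false

    βL : A ∼ 𝒜 L → β L ≡ true
    βL A∼𝒜L = from (correct L) (proj₁ A∼𝒜L ⟨T∈ L ⟩ (inj₂ refl))

theorem5p4 : (L : Subset 6) →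
    ((∃ λ d → InD d × d ∈ removeMax L) →
      ∀ (A : AxSys) → A Ax=1 → SelfRef L A → Consistent A →
        (A ∼ 𝒜 L) × (∀ d → InD d → (Surprising A d ⇔ d ∈ removeMax L)))
    × ((∀ d → InD d → d ∈ L → maxSub L ≡ just d) →
      ∀ (A : AxSys) → A Ax=1 → SelfRef L A →
        Inconsistent A × (∀ d → ¬ Surprising A d))
theorem5p4 L =
  (λ _ A _ (β , _ , A∼) → consistent-self-reference {A} {L} {β} A∼) ,
  (λ D∩L⊆max A _ (β , correct , A∼) →
    let inconsistent = D∩removeMax-empty⇒inconsistent {A} {L} {β} correct A∼
                         (D∩L⊆max⇒D∩removeMax-empty D∩L⊆max)
    in inconsistent , λ _ → inconsistent⇒¬surprising inconsistent)
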